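{- A language $\mathcal{L}\subseteq V^+$ over a finite alphabet $V$ is recognised by some $\mathbf{L}(/\to,\backslash\to)$-grammar whose assigned types all lie in $Tp_1(/,\backslash)$ if and only if $\mathcal{L}$ is generated by some linear context-free grammar.
   Context: A linear context-free grammar is $(N,\Sigma,S,P)$ with finite non-terminals $N$, terminals $\Sigma$, start symbol $S\in N$ and a finite set $P$ of productions each of the form $A\to aB$, $A\to Ba$ or $A\to a$ ($A,B\in N$, $a\in\Sigma$). Fix a finite set $Pr$ of primitive types; $Tp_1(/,\backslash)$ is the set of types of the form $A$, $A/B$ or $A\backslash B$ with $A,B\in Pr$. Sequents are $\Gamma\to\alpha$ with $\Gamma$ a non-empty finite sequence of types. $\mathbf{L}(/\to,\backslash\to)$ has Axiom $\alpha\to\alpha$; Cut: from $\Gamma,\alpha,\Theta\to\beta$ and $\Delta\to\alpha$ infer $\Gamma,\Delta,\Theta\to\beta$; $(/\to)$: from $\Gamma\to\alpha$ and $\Delta,\beta,\Theta\to\gamma$ infer $\Delta,(\beta/\alpha),\Gamma,\Theta\to\gamma$; $(\backslash\to)$: from $\Gamma\to\alpha$ and $\Delta,\beta,\Theta\to\gamma$ infer $\Delta,\Gamma,(\alpha\backslash\beta),\Theta\to\gamma$. An $\mathbf{L}(/\to,\backslash\to)$-grammar is $(Pr,V,S_{\mathcal G},f)$ with $S_{\mathcal G}\in Pr$ and $f$ assigning to each $a\in V$ a finite set of types; it recognises $w=a_1\cdots a_n\in V^+$ iff there are $\alpha_k\in f(a_k)$ with $\mathbf{L}(/\to,\backslash\to)\vdash\alpha_1,\dots,\alpha_n\to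 S_{\mathcal G}$. -}

module Defs where

open import Data.Nat using (ℕ)
open import Data.Fin using (Fin)
open import Data.List using (List; []; _∷_; _++_; [_])
open import Data.List.Membership.Propositional using (_∈_)
open import Data.List.Relation.Binary.Pointwise using (Pointwise)
open import Data.Product using (Σ; _×_; ∃; ∃-syntax)

infixl 30 _/_
infixr 30 _\\_

data Tp (P : Set) : Set where
  prim : P → Tp P
  _/_  : Tp P → Tp P → Tp P
  _\\_ : Tp P → Tp P → Tp P

data Tp₁ {P : Set} : Tp P → Set where
  tp-prim : ∀ A → Tp₁ (prim A)
  tp-/    : ∀ A B → Tp₁ (prim A / prim B)
  tp-\\   : ∀ A B → Tp₁ (prim A \\ prim B)

-- The calculus L(/→,\→)  (antecedents derivable here are automatically non-empty)

infix 4 _⊢_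

data _⊢_ {P : Set} : List (Tp P) → Tp P → Set where
  ax   : ∀ {α} → [ α ] ⊢ α
  cut  : ∀ {Γ Δ Θ α β} → (Γ ++ α ∷ Θ) ⊢ β → Δ ⊢ α → (Γ ++ Δ ++ Θ) ⊢ β
  /→   : ∀ {Γ Δ Θ α β γ} → Γ ⊢ α → (Δ ++ β ∷ Θ) ⊢ γ
         → (Δ ++ (β / α) ∷ Γ ++ Θ) ⊢ γ
  \\→  : ∀ {Γ Δ Θ α β γ} → Γ ⊢ α → (Δ ++ β ∷ Θ) ⊢ γ
         → (Δ ++ Γ ++ (α \\ β) ∷ Θ) ⊢ γ

-- L(/→,\→)-grammars over the finite alphabet Fin n.
-- Primitive types: Fin nPr; the finite type sets f(a) are given as lists.

record LGrammar (n : ℕ) : Set where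
  field
    nPr   : ℕ
    start : Fin nPr
    f     : Fin n → List (Tp (Fin nPr))

open LGrammar public

AllTp₁ : ∀ {n} → LGrammar n → Set
AllTp₁ G = ∀ a α → α ∈ f G a → Tp₁ α

Recognises : ∀ {n} → LGrammar n → List (Fin n) → Set
Recognises G w =
  ∃[ αs ] (Pointwise (λ a α → α ∈ f G a) w αs × αs ⊢ prim (start G))

data Production (k n : ℕ) : Set where
  _⟶_·_ : Fin k → Fin n → Fin k → Production k n
  _⟶_∙_ : Fin k → Fin k → Fin n → Production k n
  _⟶·_  : Fin k → Fin n → Production k n

record LinGrammar (n : ℕ) : Set where
  field
    nN    : ℕ
    S     : Fin nN
    prods : List (Production nN n)

open LinGrammar public

data Derives {n} (G : LinGrammar n) : Fin (nN G) → List (Fin n) → Set where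
  d-term  : ∀ {A a} → (A ⟶· a) ∈ prods G → Derives G A [ a ]
  d-left  : ∀ {A a B w} → (A ⟶ a · B) ∈ prods G → Derives G B w
            → Derives G A (a ∷ w)
  d-right : ∀ {A B a w} → (A ⟶ B ∙ a) ∈ prods G → Derives G B w
            → Derives G A (w ++ [ a ])

Generates : ∀ {n} → LinGrammar n → List (Fin n) → Set
Generates G w = Derives G (S G) w

-- A type in Tp₁(/,\) assigned to a letter a is the same datum as a linear
-- production with terminal a: A ↔ A → a,  A / B ↔ A → a B,  B \ A ↔ A → B a.
-- Under this dictionary the two grammars determine each other, and they
-- recognise the same words. One inclusion is a rule-by-rule simulation of
-- derivations by (/→) and (\→). The other is soundness of L(/→,\→) for the
-- language model in which a primitive type A denotes the words derivable
-- from the nonterminal A: every letter satisfies its own type exactly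
-- because the corresponding production is in the grammar.
module Submission where

open import Defs
open import Data.Nat using (ℕ)
open import Data.Fin using (Fin; _≟_)
open import Data.List using (List; []; _∷_; _++_; [_]; allFin; concatMap; map; filter)
open import Data.List.Properties using (++-assoc; ++-identityʳ)
open import Data.List.Membership.Propositional using (_∈_; mapWith∈; find; lose)
open import Data.List.Membership.Propositional.Properties
  using (∈-allFin; ∈-concatMap⁺; ∈-concatMap⁻; ∈-map⁺; ∈-map⁻; ∈-filter⁺; ∈-filter⁻)
open import Data.List.Relation.Unary.Any.Properties using (mapWith∈⁺; mapWith∈⁻)
open import Data.List.Relation.Binary.Pointwise using (Pointwise; []; _∷_; ++⁺)
open import Data.Product using (_×_; ∃-syntax; _,_)
open import Function.Bundles using (_⇔_; mk⇔)
import Function.Properties.Equivalence as ⇔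
open import Relation.Nullary using (¬_)
open import Relation.Binary.PropositionalEquality using (_≡_; refl; sym; cong; subst)

private
  variable
    k n : ℕ

module LanguageModel {P X : Set} (R : P → List X → Set) where

  ⟦_⟧ : Tp P → List X → Set
  ⟦ prim p ⟧ w = R p w
  ⟦ β / α ⟧ w = ∀ v → ⟦ α ⟧ v → ⟦ β ⟧ (w ++ v)
  ⟦ α \\ β ⟧ w = ∀ v → ⟦ α ⟧ v → ⟦ β ⟧ (v ++ w)

  data ⟦_⟧* : List (Tp P) → List X → Set where
    []  : ⟦ [] ⟧* []
    _∷_ : ∀ {α Γ u v} → ⟦ α ⟧ u → ⟦ Γ ⟧* v → ⟦ α ∷ Γ ⟧* (u ++ v)

  ⟦⟧*-++⁻ : ∀ Γ {Δ w} → ⟦ Γ ++ Δ ⟧* w →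
            ∃[ u ] ∃[ v ] (w ≡ u ++ v × ⟦ Γ ⟧* u × ⟦ Δ ⟧* v)
  ⟦⟧*-++⁻ [] s = [] , _ , refl , [] , s
  ⟦⟧*-++⁻ (α ∷ Γ) (_∷_ {u = a} x s) with ⟦⟧*-++⁻ Γ s
  ... | u , v , refl , sΓ , sΔ = a ++ u , v , sym (++-assoc a u v) , x ∷ sΓ , sΔ

  ⟦⟧*-++⁺ : ∀ {Γ Δ u v} → ⟦ Γ ⟧* u → ⟦ Δ ⟧* v → ⟦ Γ ++ Δ ⟧* (u ++ v)
  ⟦⟧*-++⁺ [] t = t
  ⟦⟧*-++⁺ {v = v} (_∷_ {α} {u = a} {v = b} x s) t =
    subst ⟦ α ∷ _ ⟧* (sym (++-assoc a b v)) (x ∷ ⟦⟧*-++⁺ s t)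

  sound : ∀ {Γ γ w} → Γ ⊢ γ → ⟦ Γ ⟧* w → ⟦ γ ⟧ w
  sound {γ = γ} ax (_∷_ {u = u} x []) = subst ⟦ γ ⟧ (sym (++-identityʳ u)) x
  sound (cut {Γ} {Δ} d e) s with ⟦⟧*-++⁻ Γ s
  ... | _ , _ , refl , sΓ , sΔΘ with ⟦⟧*-++⁻ Δ sΔΘ
  ... | _ , _ , refl , sΔ , sΘ = sound d (⟦⟧*-++⁺ sΓ (sound e sΔ ∷ sΘ))
  sound {γ = γ} (/→ {Γ} {Δ} d e) s with ⟦⟧*-++⁻ Δ s
  ... | u , _ , refl , sΔ , (_∷_ {u = b} h sΓΘ) with ⟦⟧*-++⁻ Γ sΓΘ
  ... | g , t , refl , sΓ , sΘ =
    subst ⟦ γ ⟧ (cong (u ++_) (++-assoc b g t))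
      (sound e (⟦⟧*-++⁺ sΔ (h g (sound d sΓ) ∷ sΘ)))
  sound {γ = γ} (\\→ {Γ} {Δ} d e) s with ⟦⟧*-++⁻ Δ s
  ... | u , _ , refl , sΔ , sΓΘ with ⟦⟧*-++⁻ Γ sΓΘ
  ... | g , _ , refl , sΓ , (_∷_ {u = b} {v = t} h sΘ) =
    subst ⟦ γ ⟧ (cong (u ++_) (++-assoc g b t))
      (sound e (⟦⟧*-++⁺ sΔ (h g (sound d sΓ) ∷ sΘ)))

letterOf : Production k n → Fin n
letterOf (_ ⟶· a)    = a
letterOf (_ ⟶ a · _) = a
letterOf (_ ⟶ _ ∙ a) = a

typeOf : Production k n → Tp (Fin k)
typeOf (A ⟶· _)    = prim A
typeOf (A ⟶ _ · B) = prim A / prim B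
typeOf (A ⟶ B ∙ _) = prim B \\ prim A

typeOf-Tp₁ : (x : Production k n) → Tp₁ (typeOf x)
typeOf-Tp₁ (A ⟶· _)    = tp-prim A
typeOf-Tp₁ (A ⟶ _ · B) = tp-/ A B
typeOf-Tp₁ (A ⟶ B ∙ _) = tp-\\ B A

production : ∀ {α : Tp (Fin k)} → Fin n → Tp₁ α → Production k n
production a (tp-prim A) = A ⟶· a
production a (tp-/ A B)  = A ⟶ a · B
production a (tp-\\ B A) = A ⟶ B ∙ a

letterOf-production : ∀ {α : Tp (Fin k)} (a : Fin n) (t : Tp₁ α) →
                      letterOf (production a t) ≡ a
letterOf-production a (tp-prim A) = refl
letterOf-production a (tp-/ A B)  = refl
letterOf-production a (tp-\\ B A) = refl

typeOf-production : ∀ {α : Tp (Fin k)} (a : Fin n) (t : Tp₁ α) →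
                    typeOf (production a t) ≡ α
typeOf-production a (tp-prim A) = refl
typeOf-production a (tp-/ A B)  = refl
typeOf-production a (tp-\\ B A) = refl

module Correspondence
  (H : LinGrammar n) (f : Fin n → List (Tp (Fin (nN H))))
  (assigned⇒produced : ∀ {a α} → α ∈ f a →
                       ∃[ x ] (x ∈ prods H × letterOf x ≡ a × typeOf x ≡ α))
  (produced⇒assigned : ∀ {x} → x ∈ prods H → typeOf x ∈ f (letterOf x))
  where

  G : LGrammar n
  G = record { nPr = nN H ; start = S H ; f = f }

  Assigned : List (Fin n) → List (Tp (Fin (nN H))) → Set
  Assigned = Pointwise (λ a α → α ∈ f a)

  open LanguageModel (Derives H)

  ⟦typeOf⟧ : ∀ {x} → x ∈ prods H → ⟦ typeOf x ⟧ [ letterOf x ]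
  ⟦typeOf⟧ {A ⟶· a}    x∈H = d-term x∈H
  ⟦typeOf⟧ {A ⟶ a · B} x∈H = λ _ → d-left x∈H
  ⟦typeOf⟧ {A ⟶ B ∙ a} x∈H = λ _ → d-right x∈H

  ⟦assigned⟧ : ∀ {a α} → α ∈ f a → ⟦ α ⟧ [ a ]
  ⟦assigned⟧ α∈fa with assigned⇒produced α∈fa
  ... | x , x∈H , refl , refl = ⟦typeOf⟧ x∈H

  ⟦⟧*-Assigned : ∀ {w αs} → Assigned w αs → ⟦ αs ⟧* w
  ⟦⟧*-Assigned []         = []
  ⟦⟧*-Assigned (α∈ ∷ αs∈) = ⟦assigned⟧ α∈ ∷ ⟦⟧*-Assigned αs∈

  derivable⇒derives : ∀ {w αs A} → Assigned w αs → αs ⊢ prim A → Derives H A w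
  derivable⇒derives αs∈ d = sound d (⟦⟧*-Assigned αs∈)

  derives⇒derivable : ∀ {A w} → Derives H A w → ∃[ αs ] (Assigned w αs × αs ⊢ prim A)
  derives⇒derivable (d-term x∈H) = _ , produced⇒assigned x∈H ∷ [] , ax
  derives⇒derivable (d-left {A} {B = B} x∈H d) with derives⇒derivable d
  ... | αs , αs∈ , e =
    prim A / prim B ∷ αs , produced⇒assigned x∈H ∷ αs∈ ,
    subst (λ Γ → prim A / prim B ∷ Γ ⊢ prim A) (++-identityʳ αs)
      (/→ {Γ = αs} {Δ = []} {Θ = []} e ax)
  derives⇒derivable (d-right {A} {B} x∈H d) with derives⇒derivable d
  ... | αs , αs∈ , e =
    αs ++ [ prim B \\ prim A ] , ++⁺ αs∈ (produced⇒assigned x∈H ∷ []) ,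
    \\→ {Γ = αs} {Δ = []} {Θ = []} e ax

  recognises⇔generates : ∀ w → Recognises G w ⇔ Generates H w
  recognises⇔generates w =
    mk⇔ (λ (_ , αs∈ , d) → derivable⇒derives αs∈ d) derives⇒derivable

productionsOf : (G : LGrammar n) → AllTp₁ G → Fin n → List (Production (nPr G) n)
productionsOf G tp₁ a = mapWith∈ (f G a) (λ α∈ → production a (tp₁ a _ α∈))

linGrammar : (G : LGrammar n) → AllTp₁ G → LinGrammar n
linGrammar {n} G tp₁ = record
  { nN    = nPr G
  ; S     = start G
  ; prods = concatMap (productionsOf G tp₁) (allFin n)
  }

module FromLGrammar {n} (G : LGrammar n) (tp₁ : AllTp₁ G) where

  H : LinGrammar n
  H = linGrammar G tp₁

  assigned⇒produced : ∀ {a α} → α ∈ f G a →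
                      ∃[ x ] (x ∈ prods H × letterOf x ≡ a × typeOf x ≡ α)
  assigned⇒produced {a} α∈ =
    production a t ,
    ∈-concatMap⁺ (productionsOf G tp₁) (lose (∈-allFin a) (mapWith∈⁺ _ (_ , α∈ , refl))) ,
    letterOf-production a t , typeOf-production a t
    where t = tp₁ a _ α∈

  produced⇒assigned : ∀ {x} → x ∈ prods H → typeOf x ∈ f G (letterOf x)
  produced⇒assigned x∈H with find (∈-concatMap⁻ (productionsOf G tp₁) {allFin n} x∈H)
  ... | a , _ , x∈a with mapWith∈⁻ (f G a) (λ α∈ → production a (tp₁ a _ α∈)) x∈a
  ... | α , α∈ , refl
    rewrite letterOf-production a (tp₁ a α α∈) | typeOf-production a (tp₁ a α α∈) = α∈

  open Correspondence H (f G) assigned⇒produced produced⇒assigned public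

module FromLinGrammar (H : LinGrammar n) where

  assignment : Fin n → List (Tp (Fin (nN H)))
  assignment a = map typeOf (filter (λ x → letterOf x ≟ a) (prods H))

  assigned⇒produced : ∀ {a α} → α ∈ assignment a →
                      ∃[ x ] (x ∈ prods H × letterOf x ≡ a × typeOf x ≡ α)
  assigned⇒produced {a} α∈ with ∈-map⁻ typeOf α∈
  ... | x , x∈ , refl with ∈-filter⁻ (λ x → letterOf x ≟ a) x∈
  ... | x∈H , refl = x , x∈H , refl , refl

  produced⇒assigned : ∀ {x} → x ∈ prods H → typeOf x ∈ assignment (letterOf x)
  produced⇒assigned {x} x∈H =
    ∈-map⁺ typeOf (∈-filter⁺ (λ y → letterOf y ≟ letterOf x) x∈H refl)

  open Correspondence H assignment assigned⇒produced produced⇒assigned public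

  allTp₁ : AllTp₁ G
  allTp₁ a α α∈ with assigned⇒produced α∈
  ... | x , _ , _ , refl = typeOf-Tp₁ x

proposition2 : (n : ℕ) (L : List (Fin n) → Set) → ¬ L [] →
    (∃[ G ] (AllTp₁ G × (∀ w → L w ⇔ Recognises G w)))
    ⇔ (∃[ H ] (∀ w → L w ⇔ Generates H w))
proposition2 n L _ = mk⇔ toLinear fromLinear
  where
  toLinear : ∃[ G ] (AllTp₁ G × (∀ w → L w ⇔ Recognises G w)) →
             ∃[ H ] (∀ w → L w ⇔ Generates H w)
  toLinear (G , tp₁ , L⇔G) =
    FromLGrammar.H G tp₁ ,
    λ w → ⇔.trans (L⇔G w) (FromLGrammar.recognises⇔generates G tp₁ w)

  fromLinear : ∃[ H ] (∀ w → L w ⇔ Generates H w) →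
               ∃[ G ] (AllTp₁ G × (∀ w → L w ⇔ Recognises G w))
  fromLinear (H , L⇔H) =
    FromLinGrammar.G H , FromLinGrammar.allTp₁ H ,
    λ w → ⇔.trans (L⇔H w) (⇔.sym (FromLinGrammar.recognises⇔generates H w))
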